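{- Let $T$ be a finite rooted tree and let $G$ be a finite graph. Then $$\hom(T,G)=\sum_{T'}\mathrm{dhom}(T,T')\cdot \mathrm{cr}(T',G),$$ where the sum ranges over all isomorphism types of finite rooted trees $T'$, and only finitely many terms are nonzero.
   Context: For a rooted tree $T$ and an unrooted graph $G$, $\hom(T,G)$ is the number of homomorphisms from the underlying unrooted tree of $T$ to $G$. For rooted trees $T,T'$, a homomorphism $h:T\to T'$ is depth-preserving if every vertex of $T$ has the same depth as its image, and depth-surjective if the image of $h$ contains vertices at every depth present in $T'$; $\mathrm{dhom}(T,T')$ is the number of homomorphisms $T\to T'$ that are both depth-preserving and depth-surjective. For $v\in V(G)$ and $d\ge0$, the depth-$d$ tree unfolding $T(G,v)_{\le d}$ is the rooted tree whose nodes are the walks $v=x_0,x_1,\dots,x_j$ in $G$ with $0\le j\le d$, rooted at the trivial walk $(v)$, where the parent of a walk of length $j\ge1$ is its prefix of length $j-1$ (all leaves are at depth $d$). For a finite rooted tree $T'$ of depth $d$, $\mathrm{cr}(T',G)$ is the number of vertices $v\in V(G)$ such that $T'$ is isomorphic (as a rooted tree) to $T(G,v)_{\le d}$. -}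

module Defs where

open import Data.Bool using (Bool; true; false; _∧_; _∨_; if_then_else_)
open import Data.Nat using (ℕ; zero; suc; _+_; _*_; _⊔_; _≡ᵇ_)
open import Data.Fin using (Fin)
open import Data.List using (List; []; _∷_; _++_; map; concatMap; allFin; filterᵇ; length)
open import Data.Bool.ListAction using (all; any)
open import Data.Product using (Σ; _×_; _,_; ∃₂)
open import Relation.Nullary using (Dec; yes; no; ¬_)
open import Relation.Nullary.Decidable using (map′; _×-dec_; isYes)
open import Relation.Binary.PropositionalEquality using (_≡_; refl)

-- Finite rooted trees (rose trees; the root is the outer node,
-- the children of a node are the roots of the subtrees in its list).

data RTree : Set where
  node : List RTree → RTree

-- depth of a rooted tree = maximal depth of a vertex
mutual
  height : RTree → ℕ
  height (node [])       = 0
  height (node (t ∷ ts)) = suc (heights (t ∷ ts))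

  heights : List RTree → ℕ
  heights []       = 0
  heights (t ∷ ts) = height t ⊔ heights ts

mutual
  data Pos : RTree → Set where
    root : ∀ {ts} → Pos (node ts)
    down : ∀ {ts} → PosIn ts → Pos (node ts)

  data PosIn : List RTree → Set where
    here  : ∀ {t ts} → Pos t → PosIn (t ∷ ts)
    there : ∀ {t ts} → PosIn ts → PosIn (t ∷ ts)

mutual
  allPos : (t : RTree) → List (Pos t)
  allPos (node ts) = root ∷ map down (allPosIn ts)

  allPosIn : (ts : List RTree) → List (PosIn ts)
  allPosIn []       = []
  allPosIn (t ∷ ts) = map here (allPos t) ++ map there (allPosIn ts)

mutual
  depth : ∀ {t} → Pos t → ℕ
  depth root     = 0
  depth (down p) = suc (depthIn p)

  depthIn : ∀ {ts} → PosIn ts → ℕ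
  depthIn (here p)  = depth p
  depthIn (there p) = depthIn p

isChildRoot : ∀ {ts} → PosIn ts → Bool
isChildRoot (here root)     = true
isChildRoot (here (down _)) = false
isChildRoot (there p)       = isChildRoot p

-- childOf q p : q is a child of p
mutual
  childOf : ∀ {t} → Pos t → Pos t → Bool
  childOf root     _        = false
  childOf (down q) root     = isChildRoot q
  childOf (down q) (down p) = childOfIn q p

  childOfIn : ∀ {ts} → PosIn ts → PosIn ts → Bool
  childOfIn (here q)  (here p)  = childOf q p
  childOfIn (here _)  (there _) = false
  childOfIn (there _) (here _)  = false
  childOfIn (there q) (there p) = childOfIn q p

treeAdj : ∀ {t} → Pos t → Pos t → Bool
treeAdj p q = childOf p q ∨ childOf q p

-- Maps V(T) → A, represented as A-labellings of the vertices of T,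
-- together with an enumeration of all of them.

mutual
  data Lab (A : Set) : RTree → Set where
    lnode : ∀ {ts} → A → Labs A ts → Lab A (node ts)

  data Labs (A : Set) : List RTree → Set where
    []  : Labs A []
    _∷_ : ∀ {t ts} → Lab A t → Labs A ts → Labs A (t ∷ ts)

mutual
  allLab : ∀ {A} → List A → (t : RTree) → List (Lab A t)
  allLab xs (node ts) = concatMap (λ a → map (lnode a) (allLabs xs ts)) xs

  allLabs : ∀ {A} → List A → (ts : List RTree) → List (Labs A ts)
  allLabs xs []       = [] ∷ []
  allLabs xs (t ∷ ts) =
    concatMap (λ l → map (l ∷_) (allLabs xs ts)) (allLab xs t)

mutual
  edgesOK : ∀ {A t} → (A → A → Bool) → Lab A t → Bool
  edgesOK R (lnode a ls) = childEdgesOK R a ls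

  childEdgesOK : ∀ {A ts} → (A → A → Bool) → A → Labs A ts → Bool
  childEdgesOK R a [] = true
  childEdgesOK R a (l@(lnode b _) ∷ ls) =
    R a b ∧ edgesOK R l ∧ childEdgesOK R a ls

mutual
  depthLabels : ∀ {A t} → ℕ → Lab A t → List (ℕ × A)
  depthLabels d (lnode a ls) = (d , a) ∷ depthLabelss (suc d) ls

  depthLabelss : ∀ {A ts} → ℕ → Labs A ts → List (ℕ × A)
  depthLabelss d []       = []
  depthLabelss d (l ∷ ls) = depthLabels d l ++ depthLabelss d ls

count : ∀ {A : Set} → (A → Bool) → List A → ℕ
count p xs = length (filterᵇ p xs)

record Graph : Set where
  field
    n      : ℕ
    adj    : Fin n → Fin n → Bool
    sym    : ∀ u v → adj u v ≡ adj v u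
    irrefl : ∀ v → adj v v ≡ false

open Graph public

hom : RTree → Graph → ℕ
hom T G = count (edgesOK (adj G)) (allLab (allFin (n G)) T)

isDHom : ∀ {T'} {T} → Lab (Pos T') T → Bool
isDHom {T'} h =
  edgesOK treeAdj h
  ∧ all (λ { (d , q) → depth q ≡ᵇ d }) (depthLabels 0 h)
  ∧ all (λ q → any (λ { (_ , x) → depth x ≡ᵇ depth q }) (depthLabels 0 h))
        (allPos T')

dhom : RTree → RTree → ℕ
dhom T T' = count isDHom (allLab (allPos T') T)

data Pick : RTree → List RTree → List RTree → Set where
  here  : ∀ {u us} → Pick u (u ∷ us) us
  there : ∀ {u v us rest} → Pick u us rest → Pick u (v ∷ us) (v ∷ rest)

mutual
  data _≅_ : RTree → RTree → Set where
    node : ∀ {ts us} → ts ≈ us → node ts ≅ node us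

  data _≈_ : List RTree → List RTree → Set where
    []   : [] ≈ []
    cons : ∀ {t ts u us rest} →
           Pick u us rest → t ≅ u → ts ≈ rest → (t ∷ ts) ≈ us

pick? : {P : RTree → List RTree → Set} → (∀ u r → Dec (P u r)) →
        ∀ us → Dec (Σ RTree λ u → Σ (List RTree) λ r → Pick u us r × P u r)
pick? d [] = no λ { (_ , _ , () , _) }
pick? {P} d (v ∷ vs) with d v vs
... | yes p = yes (v , vs , here , p)
... | no ¬p with pick? {λ u r → P u (v ∷ r)} (λ u r → d u (v ∷ r)) vs
...   | yes (u , r , pk , p) = yes (u , v ∷ r , there pk , p)
...   | no ¬q = no λ { (_ , _ , here , p) → ¬p p
                     ; (u , _ , there pk , p) → ¬q (u , _ , pk , p) }

mutual
  _≅?_ : ∀ t u → Dec (t ≅ u)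
  node ts ≅? node us = map′ node (λ { (node p) → p }) (ts ≈? us)

  _≈?_ : ∀ ts us → Dec (ts ≈ us)
  [] ≈? [] = yes []
  [] ≈? (_ ∷ _) = no λ ()
  (t ∷ ts) ≈? us =
    map′ (λ { (u , r , pk , p , q) → cons pk p q })
         (λ { (cons pk p q) → _ , _ , pk , p , q })
         (pick? (λ u r → (t ≅? u) ×-dec (ts ≈? r)) us)

-- T(G,v)_{≤d}: children of a walk are its one-step extensions
unfold : (G : Graph) → Fin (n G) → ℕ → RTree
unfold G v zero    = node []
unfold G v (suc d) = node (map (λ u → unfold G u d) (filterᵇ (adj G v) (allFin (n G))))

cr : RTree → Graph → ℕ
cr T' G = count (λ v → isYes (T' ≅? unfold G v (height T'))) (allFin (n G))

{-# OPTIONS --safe #-}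

-- A homomorphism from T to G sending the root to v is the same thing as a depth-preserving map
-- from T into the unfolding T(G,v) of depth height T, and both are counted by one product
-- formula: a product over the children of the root of sums over their possible images.
-- Summing over v and grouping the unfoldings by isomorphism type gives
-- hom(T,G) = Σ_{T′} p(T,T′) · #{v : T(G,v) ≅ T′}, with p(T,T′) the number of depth-preserving
-- maps T → T′.  Every such T′ has height at most height T, so these maps are automatically
-- depth-surjective and p(T,T′) = dhom(T,T′); and dhom(T,T′) ≠ 0 forces height T′ = height T,
-- so the number of such v is cr(T′,G).

module Submission where

open import Defs hiding (sym)
open import Data.Nat using (ℕ; _*_)
open import Data.List using (List; map)
open import Data.Nat.ListAction using (sum)
open import Data.List.Relation.Unary.Any using (Any)
open import Data.List.Relation.Unary.AllPairs using (AllPairs)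
open import Data.Product using (Σ; _×_)
open import Relation.Nullary using (¬_)
open import Relation.Binary.PropositionalEquality using (_≡_; _≢_)

open import Data.Bool using (Bool; true; false; T; T?; _∧_)
open import Data.Bool.ListAction using (all; any)
open import Data.Bool.Properties using (∧-assoc; ∧-zeroʳ; ∨-zeroʳ; T-≡; T-∧; ¬-not)
open import Data.Fin using (Fin)
open import Data.List using ([]; _∷_; _++_; concatMap; filterᵇ; allFin; deduplicate)
open import Data.List.Properties using (++-identityʳ; map-++; filter-++)
open import Data.List.Membership.Propositional using (_∈_; find; lose)
open import Data.List.Membership.Propositional.Properties using (∈-map⁺; ∈-++⁺ˡ; ∈-++⁺ʳ; ∈-allFin)
open import Data.List.Relation.Unary.All as All using (All; []; _∷_)
import Data.List.Relation.Unary.All.Properties as All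
open import Data.List.Relation.Unary.All.Properties using (all⁺; all⁻)
open import Data.List.Relation.Unary.Any as Any using (here; there)
import Data.List.Relation.Unary.Any.Properties as Any
open import Data.List.Relation.Unary.Any.Properties using (any⁺; any⁻; ++⁺ˡ; ++⁺ʳ)
open import Data.List.Relation.Unary.AllPairs using (_∷_)
open import Data.List.Relation.Unary.Unique.DecSetoid.Properties using (deduplicate-!)
open import Data.Nat using (zero; suc; _+_; _⊔_; _≤_; z≤n; s≤s; _≤?_; _≡ᵇ_)
open import Data.Nat.Properties
  using ( +-assoc; +-identityʳ; +-suc; +-monoʳ-≤; *-identityˡ; *-zeroʳ; *-comm; *-distribʳ-+
        ; ≤-refl; ≤-trans; ≤-antisym; m≤n⇒m<n∨m≡n; m≤m+n; m≢1+n+m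
        ; ⊔-sel; ⊔-lub; ⊔-identityʳ; m≤m⊔n; m≤n⊔m; m⊔n≤o⇒m≤o; m⊔n≤o⇒n≤o; ≡ᵇ⇒≡; ≡⇒≡ᵇ )
import Data.Nat.Properties as ℕ
open import Algebra.Properties.CommutativeSemigroup ℕ.+-commutativeSemigroup
  using () renaming (interchange to +-interchange; x∙yz≈y∙xz to +-left-swap)
open import Data.Product using (_,_; proj₁; proj₂)
open import Data.Sum using (inj₁; inj₂)
open import Data.Unit using (tt)
open import Data.Empty using (⊥-elim)
open import Function using (_∘_; flip)
open import Function.Bundles using (Equivalence)
open import Level using (0ℓ)
open import Relation.Binary.Bundles using (DecSetoid)
open import Relation.Binary.PropositionalEquality using (refl; sym; trans; cong; cong₂; subst; module ≡-Reasoning)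
open import Relation.Nullary using (yes; no; contradiction)
open import Relation.Nullary.Decidable using (isYes; toWitness)
open ≡-Reasoning

⟦_⟧ : Bool → ℕ
⟦ true ⟧  = 1
⟦ false ⟧ = 0

∑ : {A : Set} → (A → ℕ) → List A → ℕ
∑ f []       = 0
∑ f (x ∷ xs) = f x + ∑ f xs

module _ {A : Set} where

  ∑-cong : {f g : A → ℕ} → (∀ x → f x ≡ g x) → ∀ xs → ∑ f xs ≡ ∑ g xs
  ∑-cong f≗g []       = refl
  ∑-cong f≗g (x ∷ xs) = cong₂ _+_ (f≗g x) (∑-cong f≗g xs)

  ∑-zero : ∀ (xs : List A) → ∑ (λ _ → 0) xs ≡ 0
  ∑-zero []       = refl
  ∑-zero (_ ∷ xs) = ∑-zero xs

  ∑-++ : ∀ (f : A → ℕ) xs ys → ∑ f (xs ++ ys) ≡ ∑ f xs + ∑ f ys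
  ∑-++ f []       ys = refl
  ∑-++ f (x ∷ xs) ys = trans (cong (f x +_) (∑-++ f xs ys)) (sym (+-assoc (f x) _ _))

  ∑-+ : ∀ (f g : A → ℕ) xs → ∑ (λ x → f x + g x) xs ≡ ∑ f xs + ∑ g xs
  ∑-+ f g []       = refl
  ∑-+ f g (x ∷ xs) = trans (cong (f x + g x +_) (∑-+ f g xs)) (+-interchange (f x) (g x) (∑ f xs) (∑ g xs))

  ∑-*ʳ : ∀ (f : A → ℕ) c xs → ∑ (λ x → f x * c) xs ≡ ∑ f xs * c
  ∑-*ʳ f c []       = refl
  ∑-*ʳ f c (x ∷ xs) = trans (cong (f x * c +_) (∑-*ʳ f c xs)) (sym (*-distribʳ-+ c (f x) _))

  ∑-filterᵇ : ∀ (f : A → ℕ) p xs → ∑ f (filterᵇ p xs) ≡ ∑ (λ x → ⟦ p x ⟧ * f x) xs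
  ∑-filterᵇ f p []       = refl
  ∑-filterᵇ f p (x ∷ xs) with p x
  ... | true  = cong₂ _+_ (sym (+-identityʳ (f x))) (∑-filterᵇ f p xs)
  ... | false = ∑-filterᵇ f p xs

  count≡∑ : ∀ p (xs : List A) → count p xs ≡ ∑ (λ x → ⟦ p x ⟧) xs
  count≡∑ p []       = refl
  count≡∑ p (x ∷ xs) with p x
  ... | true  = cong suc (count≡∑ p xs)
  ... | false = count≡∑ p xs

  count-∧ˡ : ∀ b (p : A → Bool) xs → count (λ x → b ∧ p x) xs ≡ ⟦ b ⟧ * count p xs
  count-∧ˡ true  p xs = sym (+-identityʳ (count p xs))
  count-∧ˡ false p xs = trans (count≡∑ _ xs) (∑-zero xs)

  count-cong : ∀ {p q : A → Bool} → (∀ x → p x ≡ q x) → ∀ xs → count p xs ≡ count q xs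
  count-cong {p} {q} p≗q xs = trans (count≡∑ p xs) (trans (∑-cong (λ x → cong ⟦_⟧ (p≗q x)) xs) (sym (count≡∑ q xs)))

  ∑-congᴬ : ∀ {f g : A → ℕ} {xs} → All (λ x → f x ≡ g x) xs → ∑ f xs ≡ ∑ g xs
  ∑-congᴬ []         = refl
  ∑-congᴬ (eq ∷ eqs) = cong₂ _+_ eq (∑-congᴬ eqs)

  count≢0⇒Any : ∀ (p : A → Bool) xs → count p xs ≢ 0 → Any (λ x → T (p x)) xs
  count≢0⇒Any p []       count≢0 = contradiction refl count≢0
  count≢0⇒Any p (x ∷ xs) count≢0 with p x in px
  ... | true  = here (subst T (sym px) tt)
  ... | false = there (count≢0⇒Any p xs count≢0)

module _ {A B : Set} where

  ∑-map : ∀ (f : B → ℕ) (g : A → B) xs → ∑ f (map g xs) ≡ ∑ (λ x → f (g x)) xs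
  ∑-map f g []       = refl
  ∑-map f g (x ∷ xs) = cong (f (g x) +_) (∑-map f g xs)

  ∑-swap : ∀ (f : A → B → ℕ) xs ys → ∑ (λ x → ∑ (f x) ys) xs ≡ ∑ (λ y → ∑ (λ x → f x y) xs) ys
  ∑-swap f []       ys = sym (∑-zero ys)
  ∑-swap f (x ∷ xs) ys =
    trans (cong (∑ (f x) ys +_) (∑-swap f xs ys)) (sym (∑-+ (f x) (λ y → ∑ (λ x → f x y) xs) ys))

  count-map : ∀ (p : B → Bool) (g : A → B) xs → count p (map g xs) ≡ count (λ x → p (g x)) xs
  count-map p g xs = trans (count≡∑ p (map g xs)) (trans (∑-map _ g xs) (sym (count≡∑ _ xs)))

  count-concatMap : ∀ (p : B → Bool) (g : A → List B) xs → count p (concatMap g xs) ≡ ∑ (λ x → count p (g x)) xs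
  count-concatMap p g []       = refl
  count-concatMap p g (x ∷ xs) = begin
    count p (g x ++ concatMap g xs)              ≡⟨ count≡∑ p (g x ++ concatMap g xs) ⟩
    ∑ (λ y → ⟦ p y ⟧) (g x ++ concatMap g xs)    ≡⟨ ∑-++ _ (g x) _ ⟩
    ∑ (λ y → ⟦ p y ⟧) (g x) + ∑ (λ y → ⟦ p y ⟧) (concatMap g xs)
      ≡⟨ cong₂ _+_ (sym (count≡∑ p (g x))) (sym (count≡∑ p (concatMap g xs))) ⟩
    count p (g x) + count p (concatMap g xs)     ≡⟨ cong (count p (g x) +_) (count-concatMap p g xs) ⟩
    count p (g x) + ∑ (λ x → count p (g x)) xs   ∎

sum-map≡∑ : ∀ {A : Set} (f : A → ℕ) xs → sum (map f xs) ≡ ∑ f xs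
sum-map≡∑ f []       = refl
sum-map≡∑ f (x ∷ xs) = cong (f x +_) (sum-map≡∑ f xs)

module _ (D : DecSetoid 0ℓ 0ℓ) where
  open DecSetoid D using (Carrier; _≟_) renaming (_≈_ to _∼_; sym to ∼-sym; trans to ∼-trans)
  open import Data.List.Relation.Unary.Unique.Setoid (DecSetoid.setoid D) using (Unique)

  ∑-representative : ∀ (f : Carrier → ℕ) → (∀ {x y} → x ∼ y → f x ≡ f y) →
                     ∀ {xs y} → Unique xs → Any (y ∼_) xs → ∑ (λ x → ⟦ isYes (x ≟ y) ⟧ * f x) xs ≡ f y
  ∑-representative f f-cong {x ∷ xs} {y} (x≁xs ∷ _) (here y∼x) with x ≟ y
  ... | no x≁y  = contradiction (∼-sym y∼x) x≁y
  ... | yes x∼y = begin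
    f x + 0 + ∑ (λ z → ⟦ isYes (z ≟ y) ⟧ * f z) xs  ≡⟨ cong₂ _+_ (+-identityʳ (f x)) (∑-congᴬ (All.map vanish x≁xs)) ⟩
    f x + ∑ (λ _ → 0) xs                             ≡⟨ cong (f x +_) (∑-zero xs) ⟩
    f x + 0                                          ≡⟨ +-identityʳ (f x) ⟩
    f x                                              ≡⟨ f-cong x∼y ⟩
    f y                                              ∎
    where
      vanish : ∀ {z} → ¬ x ∼ z → ⟦ isYes (z ≟ y) ⟧ * f z ≡ 0
      vanish {z} x≁z with z ≟ y
      ... | yes z∼y = contradiction (∼-trans x∼y (∼-sym z∼y)) x≁z
      ... | no _    = refl
  ∑-representative f f-cong {x ∷ xs} {y} (x≁xs ∷ unique) (there y∈xs) with x ≟ y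
  ... | no _    = ∑-representative f f-cong unique y∈xs
  ... | yes x∼y with All.lookupAny x≁xs y∈xs
  ...   | x≁z , y∼z = contradiction (∼-trans x∼y y∼z) x≁z

filterᵇ-false : ∀ {A : Set} (xs : List A) → filterᵇ (λ _ → false) xs ≡ []
filterᵇ-false []       = refl
filterᵇ-false (_ ∷ xs) = filterᵇ-false xs

module _ {A B C : Set} where

  map-filterᵇ-map : ∀ (g : B → C) p (f : A → B) xs →
                    map g (filterᵇ p (map f xs)) ≡ map (g ∘ f) (filterᵇ (p ∘ f) xs)
  map-filterᵇ-map g p f []       = refl
  map-filterᵇ-map g p f (x ∷ xs) with p (f x)
  ... | true  = cong (g (f x) ∷_) (map-filterᵇ-map g p f xs)
  ... | false = map-filterᵇ-map g p f xs

module _ {A B : Set} where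

  map-filterᵇ-++ : ∀ (g : A → B) p xs ys →
                   map g (filterᵇ p (xs ++ ys)) ≡ map g (filterᵇ p xs) ++ map g (filterᵇ p ys)
  map-filterᵇ-++ g p xs ys = trans (cong (map g) (filter-++ (T? ∘ p) xs ys)) (map-++ g (filterᵇ p xs) (filterᵇ p ys))

all-++ : ∀ {A : Set} (p : A → Bool) xs ys → all p (xs ++ ys) ≡ all p xs ∧ all p ys
all-++ p []       ys = refl
all-++ p (x ∷ xs) ys = trans (cong (p x ∧_) (all-++ p xs ys)) (sym (∧-assoc (p x) _ _))

∧-interchange : ∀ a b c d e → (a ∧ b ∧ c) ∧ (d ∧ e) ≡ (a ∧ (b ∧ d)) ∧ (c ∧ e)
∧-interchange false _     _     _ _ = refl
∧-interchange true  false _     _ _ = refl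
∧-interchange true  true  false d _ = sym (∧-zeroʳ d)
∧-interchange true  true  true  _ _ = refl

∧-dropʳ : ∀ a b → (T a → T b) → a ∧ b ≡ a
∧-dropʳ false _     _   = refl
∧-dropʳ true  true  _   = refl
∧-dropʳ true  false a⇒b = ⊥-elim (a⇒b tt)

≡ᵇ-refl : ∀ n → (n ≡ᵇ n) ≡ true
≡ᵇ-refl n = Equivalence.to T-≡ (≡⇒≡ᵇ n n refl)

≢⇒≡ᵇ-false : ∀ {m n} → m ≢ n → (m ≡ᵇ n) ≡ false
≢⇒≡ᵇ-false {m} {n} m≢n = ¬-not (λ eq → m≢n (≡ᵇ⇒≡ m n (Equivalence.from T-≡ eq)))

≤+⊔-right : ∀ {j} d m n → j ≤ d + (m ⊔ n) → ¬ j ≤ d + m → j ≤ d + n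
≤+⊔-right {j} d m n j≤ j≰ with ⊔-sel m n
... | inj₁ m⊔n≡m = contradiction (subst (λ x → j ≤ d + x) m⊔n≡m j≤) j≰
... | inj₂ m⊔n≡n = subst (λ x → j ≤ d + x) m⊔n≡n j≤

m*n≢0⇒m≢0×n≢0 : ∀ m n → m * n ≢ 0 → m ≢ 0 × n ≢ 0
m*n≢0⇒m≢0×n≢0 m n m*n≢0 = (λ m≡0 → m*n≢0 (cong (_* n) m≡0)) , (λ n≡0 → m*n≢0 (trans (cong (m *_) n≡0) (*-zeroʳ m)))

rootLabel : ∀ {X t} → Lab X t → X
rootLabel (lnode x _) = x

-- rootedHoms next t x counts the labellings of t with root label x in which the label of every
-- child of a vertex labelled y is chosen from next y (with multiplicity).
module _ {X : Set} (next : X → List X) where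
  mutual
    rootedHoms : RTree → X → ℕ
    rootedHoms (node ts) x = rootedHomsAll ts x

    rootedHomsAll : List RTree → X → ℕ
    rootedHomsAll []       x = 1
    rootedHomsAll (t ∷ ts) x = ∑ (rootedHoms t) (next x) * rootedHomsAll ts x

module _ {X : Set} (R : X → X → Bool) (xs : List X) where

  private
    next : X → List X
    next x = filterᵇ (R x) xs

  childEdgesOK-∷ : ∀ {t} x (l : Lab X t) {ts} (ls : Labs X ts) →
                   childEdgesOK R x (l ∷ ls) ≡ (R x (rootLabel l) ∧ edgesOK R l) ∧ childEdgesOK R x ls
  childEdgesOK-∷ x (lnode y _) ls = sym (∧-assoc (R x y) _ _)

  mutual
    count-edgesOK : ∀ (p : X → Bool) t →
                    count (λ l → p (rootLabel l) ∧ edgesOK R l) (allLab xs t)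
                    ≡ ∑ (λ x → ⟦ p x ⟧ * rootedHoms next t x) xs
    count-edgesOK p (node ts) = begin
      count (λ l → p (rootLabel l) ∧ edgesOK R l) (concatMap (λ x → map (lnode x) (allLabs xs ts)) xs)
        ≡⟨ count-concatMap _ _ xs ⟩
      ∑ (λ x → count (λ l → p (rootLabel l) ∧ edgesOK R l) (map (lnode x) (allLabs xs ts))) xs
        ≡⟨ ∑-cong (λ x → count-map _ (lnode x) (allLabs xs ts)) xs ⟩
      ∑ (λ x → count (λ ls → p x ∧ childEdgesOK R x ls) (allLabs xs ts)) xs
        ≡⟨ ∑-cong (λ x → count-∧ˡ (p x) _ (allLabs xs ts)) xs ⟩
      ∑ (λ x → ⟦ p x ⟧ * count (childEdgesOK R x) (allLabs xs ts)) xs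
        ≡⟨ ∑-cong (λ x → cong (⟦ p x ⟧ *_) (count-childEdgesOK x ts)) xs ⟩
      ∑ (λ x → ⟦ p x ⟧ * rootedHomsAll next ts x) xs
        ∎

    count-childEdgesOK : ∀ x ts → count (childEdgesOK R x) (allLabs xs ts) ≡ rootedHomsAll next ts x
    count-childEdgesOK x []       = refl
    count-childEdgesOK x (t ∷ ts) = begin
      count (childEdgesOK R x) (concatMap (λ l → map (l ∷_) (allLabs xs ts)) (allLab xs t))
        ≡⟨ count-concatMap _ _ (allLab xs t) ⟩
      ∑ (λ l → count (childEdgesOK R x) (map (l ∷_) (allLabs xs ts))) (allLab xs t)
        ≡⟨ ∑-cong (λ l → trans (count-map _ (l ∷_) (allLabs xs ts))
                         (trans (count-cong (childEdgesOK-∷ x l) (allLabs xs ts))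
                                (count-∧ˡ _ (childEdgesOK R x) (allLabs xs ts)))) (allLab xs t) ⟩
      ∑ (λ l → ⟦ R x (rootLabel l) ∧ edgesOK R l ⟧ * count (childEdgesOK R x) (allLabs xs ts)) (allLab xs t)
        ≡⟨ trans (∑-*ʳ _ _ (allLab xs t)) (cong (_* _) (sym (count≡∑ _ (allLab xs t)))) ⟩
      count (λ l → R x (rootLabel l) ∧ edgesOK R l) (allLab xs t) * count (childEdgesOK R x) (allLabs xs ts)
        ≡⟨ cong₂ _*_ (count-edgesOK (R x) t) (count-childEdgesOK x ts) ⟩
      ∑ (λ y → ⟦ R x y ⟧ * rootedHoms next t y) xs * rootedHomsAll next ts x
        ≡⟨ cong (_* _) (sym (∑-filterᵇ (rootedHoms next t) (R x) xs)) ⟩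
      ∑ (rootedHoms next t) (next x) * rootedHomsAll next ts x
        ∎

height-children : ∀ {k} ts → height (node ts) ≤ suc k → All (λ t → height t ≤ k) ts
height-children []       _       = []
height-children (t ∷ ts) (s≤s h) = go (t ∷ ts) h
  where
    go : ∀ {k} ts → heights ts ≤ k → All (λ t → height t ≤ k) ts
    go []       _ = []
    go (t ∷ ts) h = m⊔n≤o⇒m≤o (height t) _ h ∷ go ts (m⊔n≤o⇒n≤o (height t) _ h)

module _ {X Y : Set} (next : X → List X) (next′ : Y → List Y) (f : ℕ → X → Y)
         (next-f : ∀ k x → next′ (f (suc k) x) ≡ map (f k) (next x)) where

  mutual
    rootedHoms-simulate : ∀ k t x → height t ≤ k → rootedHoms next t x ≡ rootedHoms next′ t (f k x)
    rootedHoms-simulate zero    (node [])      x _ = refl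
    rootedHoms-simulate zero    (node (_ ∷ _)) x ()
    rootedHoms-simulate (suc k) (node ts)      x h = rootedHomsAll-simulate k ts x (height-children ts h)

    rootedHomsAll-simulate : ∀ k ts x → All (λ t → height t ≤ k) ts →
                             rootedHomsAll next ts x ≡ rootedHomsAll next′ ts (f (suc k) x)
    rootedHomsAll-simulate k []       x []       = refl
    rootedHomsAll-simulate k (t ∷ ts) x (h ∷ hs) = cong₂ _*_ sums (rootedHomsAll-simulate k ts x hs)
      where
        sums : ∑ (rootedHoms next t) (next x) ≡ ∑ (rootedHoms next′ t) (next′ (f (suc k) x))
        sums = begin
          ∑ (rootedHoms next t) (next x)                 ≡⟨ ∑-cong (λ y → rootedHoms-simulate k t y h) (next x) ⟩
          ∑ (λ y → rootedHoms next′ t (f k y)) (next x)  ≡⟨ sym (∑-map _ (f k) (next x)) ⟩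
          ∑ (rootedHoms next′ t) (map (f k) (next x))    ≡⟨ cong (∑ (rootedHoms next′ t)) (sym (next-f k x)) ⟩
          ∑ (rootedHoms next′ t) (next′ (f (suc k) x))   ∎

mutual
  ≅-refl : ∀ t → t ≅ t
  ≅-refl (node ts) = node (≈-refl ts)

  ≈-refl : ∀ ts → ts ≈ ts
  ≈-refl []       = []
  ≈-refl (t ∷ ts) = cons here (≅-refl t) (≈-refl ts)

≈-insert : ∀ {u v us rest vs} → Pick u us rest → rest ≈ vs → u ≅ v → us ≈ (v ∷ vs)
≈-insert here        q                 u≅v = cons here u≅v q
≈-insert (there pk) (cons pk′ p′ q′) u≅v = cons (there pk′) p′ (≈-insert pk q′ u≅v)

mutual
  ≅-sym : ∀ {t u} → t ≅ u → u ≅ t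
  ≅-sym (node p) = node (≈-sym p)

  ≈-sym : ∀ {ts us} → ts ≈ us → us ≈ ts
  ≈-sym []            = []
  ≈-sym (cons pk p q) = ≈-insert pk (≈-sym q) (≅-sym p)

Pick-swap : ∀ {u v us rest rest′} → Pick u us rest → Pick v rest rest′ →
            Σ (List RTree) λ rest″ → Pick v us rest″ × Pick u rest″ rest′
Pick-swap here        pk         = _ , there pk , here
Pick-swap (there pk₁) here       = _ , here , pk₁
Pick-swap (there pk₁) (there pk₂) with Pick-swap pk₁ pk₂
... | _ , pk₃ , pk₄ = _ , there pk₃ , there pk₄

Pick-≈ : ∀ {u us rest vs} → Pick u us rest → us ≈ vs →
         Σ RTree λ v → Σ (List RTree) λ rest′ → Pick v vs rest′ × u ≅ v × rest ≈ rest′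
Pick-≈ here        (cons pk p q) = _ , _ , pk , p , q
Pick-≈ (there pk) (cons pk′ p q) with Pick-≈ pk q
... | v , _ , pk₂ , u≅v , r with Pick-swap pk′ pk₂
...   | _ , pk₃ , pk₄ = v , _ , pk₃ , u≅v , cons pk₄ p r

mutual
  ≅-trans : ∀ {t u v} → t ≅ u → u ≅ v → t ≅ v
  ≅-trans (node p) (node q) = node (≈-trans p q)

  ≈-trans : ∀ {ts us vs} → ts ≈ us → us ≈ vs → ts ≈ vs
  ≈-trans []            [] = []
  ≈-trans (cons pk p q) r with Pick-≈ pk r
  ... | _ , _ , pk₂ , u≅v , r′ = cons pk₂ (≅-trans p u≅v) (≈-trans q r′)

≅-decSetoid : DecSetoid 0ℓ 0ℓ
≅-decSetoid = record
  { Carrier          = RTree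
  ; _≈_              = _≅_
  ; isDecEquivalence = record
    { isEquivalence = record { refl = ≅-refl _ ; sym = ≅-sym ; trans = ≅-trans }
    ; _≟_           = _≅?_
    }
  }

∑-Pick : ∀ (f : RTree → ℕ) {u us rest} → Pick u us rest → ∑ f us ≡ f u + ∑ f rest
∑-Pick f here = refl
∑-Pick f {u} (there {v = v} {rest = rest} pk) =
  trans (cong (f v +_) (∑-Pick f pk)) (+-left-swap (f v) (f u) (∑ f rest))

∑-≈ : ∀ (f : RTree → ℕ) → (∀ {s s′} → s ≅ s′ → f s ≡ f s′) → ∀ {ts us} → ts ≈ us → ∑ f ts ≡ ∑ f us
∑-≈ f f-cong []            = refl
∑-≈ f f-cong (cons pk p q) = trans (cong₂ _+_ (f-cong p) (∑-≈ f f-cong q)) (sym (∑-Pick f pk))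

children : RTree → List RTree
children (node ts) = ts

-- Root-preserving maps t → s sending children to children: the depth-preserving homomorphisms,
-- without depth-surjectivity.
dphom : RTree → RTree → ℕ
dphom = rootedHoms children

mutual
  dphom-cong : ∀ t {s s′} → s ≅ s′ → dphom t s ≡ dphom t s′
  dphom-cong (node ts) (node p) = dphomAll-cong ts p

  dphomAll-cong : ∀ ts {ss ss′} → ss ≈ ss′ → rootedHomsAll children ts (node ss) ≡ rootedHomsAll children ts (node ss′)
  dphomAll-cong []       p = refl
  dphomAll-cong (t ∷ ts) p = cong₂ _*_ (∑-≈ (dphom t) (dphom-cong t) p) (dphomAll-cong ts p)

neighbours : (G : Graph) → Fin (n G) → List (Fin (n G))
neighbours G v = filterᵇ (adj G v) (allFin (n G))

mutual
  height-unfold : ∀ G v k → height (unfold G v k) ≤ k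
  height-unfold G v zero    = z≤n
  height-unfold G v (suc k) with neighbours G v
  ... | []     = z≤n
  ... | u ∷ us = s≤s (heights-unfold G k (u ∷ us))

  heights-unfold : ∀ G k us → heights (map (λ u → unfold G u k) us) ≤ k
  heights-unfold G k []       = z≤n
  heights-unfold G k (u ∷ us) = ⊔-lub (height-unfold G u k) (heights-unfold G k us)

hom≡∑dphom : ∀ t G → hom t G ≡ ∑ (λ v → dphom t (unfold G v (height t))) (allFin (n G))
hom≡∑dphom t G = begin
  hom t G                                           ≡⟨ count-edgesOK (adj G) vs (λ _ → true) t ⟩
  ∑ (λ v → 1 * rootedHoms (neighbours G) t v) vs    ≡⟨ ∑-cong (λ v → trans (*-identityˡ _) (into-unfolding v)) vs ⟩
  ∑ (λ v → dphom t (unfold G v (height t))) vs      ∎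
  where
    vs : List (Fin (n G))
    vs = allFin (n G)
    into-unfolding : ∀ v → rootedHoms (neighbours G) t v ≡ dphom t (unfold G v (height t))
    into-unfolding v =
      rootedHoms-simulate (neighbours G) children (λ k v → unfold G v k) (λ _ _ → refl) (height t) t v ≤-refl

mutual
  subtree : ∀ {t} → Pos t → RTree
  subtree {t} root     = t
  subtree     (down p) = subtreeIn p

  subtreeIn : ∀ {ts} → PosIn ts → RTree
  subtreeIn (here p)  = subtree p
  subtreeIn (there p) = subtreeIn p

childPositions : ∀ {t} → Pos t → List (Pos t)
childPositions {t} a = filterᵇ (λ b → childOf b a) (allPos t)

subtree-childRoots : ∀ ts → map subtreeIn (filterᵇ isChildRoot (allPosIn ts)) ≡ ts
subtree-childRoots []              = refl
subtree-childRoots (node us ∷ ts) =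
  cong (node us ∷_) (trans (map-filterᵇ-++ subtreeIn isChildRoot inFirst inRest) (cong₂ _++_ none rest))
  where
    inFirst : List (PosIn (node us ∷ ts))
    inFirst = map here (map down (allPosIn us))
    inRest : List (PosIn (node us ∷ ts))
    inRest = map there (allPosIn ts)
    none : map subtreeIn (filterᵇ isChildRoot inFirst) ≡ []
    none = trans (map-filterᵇ-map subtreeIn isChildRoot here (map down (allPosIn us)))
                 (trans (map-filterᵇ-map _ _ down (allPosIn us))
                        (cong (map _) (filterᵇ-false (allPosIn us))))
    rest : map subtreeIn (filterᵇ isChildRoot inRest) ≡ ts
    rest = trans (map-filterᵇ-map subtreeIn isChildRoot there (allPosIn ts)) (subtree-childRoots ts)

mutual
  subtree-childPositions : ∀ {t} (a : Pos t) → map subtree (childPositions a) ≡ children (subtree a)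
  subtree-childPositions {node ts} root     =
    trans (map-filterᵇ-map subtree _ down (allPosIn ts)) (subtree-childRoots ts)
  subtree-childPositions {node ts} (down p) =
    trans (map-filterᵇ-map subtree _ down (allPosIn ts)) (subtree-childPositionsIn p)

  subtree-childPositionsIn : ∀ {ts} (p : PosIn ts) →
    map subtreeIn (filterᵇ (λ q → childOfIn q p) (allPosIn ts)) ≡ children (subtreeIn p)
  subtree-childPositionsIn {t ∷ ts} (here p) =
    trans (map-filterᵇ-++ subtreeIn _ (map here (allPos t)) (map there (allPosIn ts)))
          (trans (cong₂ _++_ inHead none) (++-identityʳ _))
    where
      inHead : map subtreeIn (filterᵇ (λ q → childOfIn q (here p)) (map here (allPos t))) ≡ children (subtree p)
      inHead = trans (map-filterᵇ-map subtreeIn _ here (allPos t)) (subtree-childPositions p)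
      none : map subtreeIn (filterᵇ (λ q → childOfIn q (here p)) (map (there {t}) (allPosIn ts))) ≡ []
      none = trans (map-filterᵇ-map subtreeIn _ there (allPosIn ts)) (cong (map _) (filterᵇ-false (allPosIn ts)))
  subtree-childPositionsIn {t ∷ ts} (there p) =
    trans (map-filterᵇ-++ subtreeIn _ (map here (allPos t)) (map there (allPosIn ts))) (cong₂ _++_ none inTail)
    where
      none : map subtreeIn (filterᵇ (λ q → childOfIn q (there p)) (map (here {ts = ts}) (allPos t))) ≡ []
      none = trans (map-filterᵇ-map subtreeIn _ here (allPos t)) (cong (map _) (filterᵇ-false (allPos t)))
      inTail : map subtreeIn (filterᵇ (λ q → childOfIn q (there p)) (map there (allPosIn ts))) ≡ children (subtreeIn p)
      inTail = trans (map-filterᵇ-map subtreeIn _ there (allPosIn ts)) (subtree-childPositionsIn p)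

isChildRoot⇒depth : ∀ {ts} (q : PosIn ts) → isChildRoot q ≡ true → depthIn q ≡ 0
isChildRoot⇒depth (here root)     _  = refl
isChildRoot⇒depth (there q)       eq = isChildRoot⇒depth q eq

mutual
  childOf⇒depth : ∀ {t} (b a : Pos t) → childOf b a ≡ true → depth b ≡ suc (depth a)
  childOf⇒depth (down q) root     eq = cong suc (isChildRoot⇒depth q eq)
  childOf⇒depth (down q) (down p) eq = cong suc (childOfIn⇒depth q p eq)

  childOfIn⇒depth : ∀ {ts} (q p : PosIn ts) → childOfIn q p ≡ true → depthIn q ≡ suc (depthIn p)
  childOfIn⇒depth (here q)  (here p)  eq = childOf⇒depth q p eq
  childOfIn⇒depth (there q) (there p) eq = childOfIn⇒depth q p eq

treeAdj-depth : ∀ {t} (a b : Pos t) → treeAdj a b ∧ (depth b ≡ᵇ suc (depth a)) ≡ childOf b a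
treeAdj-depth a b with childOf b a in b◃a
... | true rewrite ∨-zeroʳ (childOf a b) | childOf⇒depth b a b◃a = ≡ᵇ-refl (suc (depth a))
... | false with childOf a b in a◃b
...   | false = refl
...   | true rewrite childOf⇒depth a b a◃b = ≢⇒≡ᵇ-false (m≢1+n+m (depth b) {1})

mutual
  depthLabels-attains : ∀ {X t} (l : Lab X t) d j → d ≤ j → j ≤ d + height t →
                        Any (λ e → proj₁ e ≡ j) (depthLabels d l)
  depthLabels-attains {t = node []} (lnode _ []) d j d≤j j≤d+0 =
    here (≤-antisym d≤j (subst (j ≤_) (+-identityʳ d) j≤d+0))
  depthLabels-attains {t = node (u ∷ us)} (lnode _ ls) d j d≤j j≤ with m≤n⇒m<n∨m≡n d≤j
  ... | inj₂ d≡j = here d≡j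
  ... | inj₁ d<j = there (depthLabelss-attains ls (suc d) j d<j (subst (j ≤_) (+-suc d _) j≤))

  depthLabelss-attains : ∀ {X u us} (ls : Labs X (u ∷ us)) d j → d ≤ j → j ≤ d + heights (u ∷ us) →
                         Any (λ e → proj₁ e ≡ j) (depthLabelss d ls)
  depthLabelss-attains {u = u} {us} (l ∷ ls) d j d≤j j≤ with j ≤? d + height u
  ... | yes j≤u = ++⁺ˡ (depthLabels-attains l d j d≤j j≤u)
  depthLabelss-attains {u = u} {[]} (l ∷ ls) d j d≤j j≤ | no j≰u =
    contradiction (subst (λ x → j ≤ d + x) (⊔-identityʳ (height u)) j≤) j≰u
  depthLabelss-attains {u = u} {_ ∷ _} (l ∷ ls) d j d≤j j≤ | no j≰u =
    ++⁺ʳ (depthLabels d l) (depthLabelss-attains ls d j d≤j (≤+⊔-right d (height u) _ j≤ j≰u))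

mutual
  depthLabels-bounded : ∀ {X t} (l : Lab X t) d → All (λ e → proj₁ e ≤ d + height t) (depthLabels d l)
  depthLabels-bounded {t = node []}       (lnode _ []) d = m≤m+n d 0 ∷ []
  depthLabels-bounded {t = node (u ∷ us)} (lnode _ ls) d =
    m≤m+n d _ ∷ All.map (λ {e} → subst (proj₁ e ≤_) (sym (+-suc d _))) (depthLabelss-bounded ls (suc d))

  depthLabelss-bounded : ∀ {X ts} (ls : Labs X ts) d → All (λ e → proj₁ e ≤ d + heights ts) (depthLabelss d ls)
  depthLabelss-bounded []                  d = []
  depthLabelss-bounded {ts = u ∷ us} (l ∷ ls) d =
    All.++⁺ (All.map (λ le → ≤-trans le (+-monoʳ-≤ d (m≤m⊔n (height u) (heights us)))) (depthLabels-bounded l d))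
            (All.map (λ le → ≤-trans le (+-monoʳ-≤ d (m≤n⊔m (height u) (heights us)))) (depthLabelss-bounded ls d))

mutual
  deepest : ∀ t → Σ (Pos t) λ q → depth q ≡ height t
  deepest (node [])       = root , refl
  deepest (node (u ∷ us)) with deepestIn u us
  ... | q , q-deepest = down q , cong suc q-deepest

  deepestIn : ∀ u us → Σ (PosIn (u ∷ us)) λ q → depthIn q ≡ heights (u ∷ us)
  deepestIn u us with ⊔-sel (height u) (heights us)
  deepestIn u us           | inj₁ u-max with deepest u
  ... | q , q-deepest = here q , trans q-deepest (sym u-max)
  deepestIn (node _) []    | inj₂ us-max = here root , sym us-max
  deepestIn u (u′ ∷ us)    | inj₂ us-max with deepestIn u′ us
  ... | q , q-deepest = there q , trans q-deepest (sym us-max)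

mutual
  depth≤height : ∀ {t} (q : Pos t) → depth q ≤ height t
  depth≤height root                       = z≤n
  depth≤height {node (_ ∷ _)} (down p)    = s≤s (depthIn≤heights p)

  depthIn≤heights : ∀ {ts} (p : PosIn ts) → depthIn p ≤ heights ts
  depthIn≤heights {u ∷ us} (here p)  = ≤-trans (depth≤height p) (m≤m⊔n (height u) (heights us))
  depthIn≤heights {u ∷ us} (there p) = ≤-trans (depthIn≤heights p) (m≤n⊔m (height u) (heights us))

mutual
  ∈-allPos : ∀ {t} (q : Pos t) → q ∈ allPos t
  ∈-allPos root     = here refl
  ∈-allPos (down p) = there (∈-map⁺ down (∈-allPosIn p))

  ∈-allPosIn : ∀ {ts} (p : PosIn ts) → p ∈ allPosIn ts
  ∈-allPosIn {t ∷ ts} (here p)  = ∈-++⁺ˡ (∈-map⁺ here (∈-allPos p))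
  ∈-allPosIn {t ∷ ts} (there p) = ∈-++⁺ʳ (map here (allPos t)) (∈-map⁺ there (∈-allPosIn p))

module _ {S : RTree} where

  levelled : ℕ × Pos S → Bool
  levelled (d , q) = depth q ≡ᵇ d

  parentOf : Pos S → Pos S → Bool
  parentOf = flip childOf

  -- Once depths are preserved, an edge of t can only go to an edge of S in the same orientation.
  mutual
    levelled-edgesOK : ∀ {t} d (l : Lab (Pos S) t) →
      edgesOK treeAdj l ∧ all levelled (depthLabels d l) ≡ (depth (rootLabel l) ≡ᵇ d) ∧ edgesOK parentOf l
    levelled-edgesOK d (lnode a ls) with depth a ≡ᵇ d in eq
    ... | false = ∧-zeroʳ (childEdgesOK treeAdj a ls)
    ... | true  = levelled-childEdgesOK d a (≡ᵇ⇒≡ _ _ (Equivalence.from T-≡ eq)) ls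

    levelled-childEdgesOK : ∀ {ts} d a → depth a ≡ d → (ls : Labs (Pos S) ts) →
      childEdgesOK treeAdj a ls ∧ all levelled (depthLabelss (suc d) ls) ≡ childEdgesOK parentOf a ls
    levelled-childEdgesOK d a a≡d [] = refl
    levelled-childEdgesOK d a a≡d (l@(lnode b _) ∷ ls) = begin
      (treeAdj a b ∧ E ∧ Es) ∧ all levelled (depthLabels (suc d) l ++ depthLabelss (suc d) ls)
        ≡⟨ cong ((treeAdj a b ∧ E ∧ Es) ∧_) (all-++ levelled (depthLabels (suc d) l) _) ⟩
      (treeAdj a b ∧ E ∧ Es) ∧ (L ∧ Ls)
        ≡⟨ ∧-interchange (treeAdj a b) E Es L Ls ⟩
      (treeAdj a b ∧ (E ∧ L)) ∧ (Es ∧ Ls)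
        ≡⟨ cong₂ (λ x y → (treeAdj a b ∧ x) ∧ y) (levelled-edgesOK (suc d) l) (levelled-childEdgesOK d a a≡d ls) ⟩
      (treeAdj a b ∧ ((depth b ≡ᵇ suc d) ∧ edgesOK parentOf l)) ∧ childEdgesOK parentOf a ls
        ≡⟨ cong (_∧ childEdgesOK parentOf a ls) (sym (∧-assoc (treeAdj a b) _ _)) ⟩
      ((treeAdj a b ∧ (depth b ≡ᵇ suc d)) ∧ edgesOK parentOf l) ∧ childEdgesOK parentOf a ls
        ≡⟨ cong (λ x → (x ∧ edgesOK parentOf l) ∧ childEdgesOK parentOf a ls)
                (trans (cong (λ d → treeAdj a b ∧ (depth b ≡ᵇ suc d)) (sym a≡d)) (treeAdj-depth a b)) ⟩
      (childOf b a ∧ edgesOK parentOf l) ∧ childEdgesOK parentOf a ls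
        ≡⟨ ∧-assoc (childOf b a) _ _ ⟩
      childOf b a ∧ edgesOK parentOf l ∧ childEdgesOK parentOf a ls ∎
      where
        E Es L Ls : Bool
        E  = edgesOK treeAdj l
        Es = childEdgesOK treeAdj a ls
        L  = all levelled (depthLabels (suc d) l)
        Ls = all levelled (depthLabelss (suc d) ls)

depthSurjective : ∀ {s t} → Lab (Pos s) t → Bool
depthSurjective {s} h = all (λ q → any (λ e → depth (proj₂ e) ≡ᵇ depth q) (depthLabels 0 h)) (allPos s)

levelled⇒depthSurjective : ∀ {s t} (h : Lab (Pos s) t) → height s ≤ height t →
                           T (all levelled (depthLabels 0 h)) → T (depthSurjective h)
levelled⇒depthSurjective {s} h s≤t levels = all⁻ _ {allPos s} (All.tabulate (λ {q} _ → any⁺ _ (image-at-depth q)))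
  where
    image-at-depth : ∀ q → Any (λ e → T (depth (proj₂ e) ≡ᵇ depth q)) (depthLabels 0 h)
    image-at-depth q with find (depthLabels-attains h 0 (depth q) z≤n (≤-trans (depth≤height q) s≤t))
    ... | (d , x) , e∈ , d≡depth = lose e∈ (≡⇒≡ᵇ (depth x) (depth q) (trans x-depth d≡depth))
      where
        x-depth : depth x ≡ d
        x-depth = ≡ᵇ⇒≡ (depth x) d (All.lookup (all⁺ levelled (depthLabels 0 h) levels) e∈)

isDHom⇒height≡ : ∀ {s t} (h : Lab (Pos s) t) → T (isDHom h) → height s ≡ height t
isDHom⇒height≡ {s} {t} h isDHom-h = ≤-antisym s≤t t≤s
  where
    levelled∧surjective : T (all levelled (depthLabels 0 h)) × T (depthSurjective h)
    levelled∧surjective = Equivalence.to T-∧ (proj₂ (Equivalence.to (T-∧ {edgesOK treeAdj h}) isDHom-h))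
    levels : All (T ∘ levelled) (depthLabels 0 h)
    levels = all⁺ levelled _ (proj₁ levelled∧surjective)
    surjective : T (depthSurjective h)
    surjective = proj₂ levelled∧surjective

    t≤s : height t ≤ height s
    t≤s with find (depthLabels-attains h 0 (height t) z≤n ≤-refl)
    ... | (_ , x) , e∈ , e-depth =
      subst (_≤ height s) (trans (≡ᵇ⇒≡ (depth x) _ (All.lookup levels e∈)) e-depth) (depth≤height x)

    s≤t : height s ≤ height t
    s≤t with deepest s
    ... | q , q-deepest with find (any⁻ (λ e → depth (proj₂ e) ≡ᵇ depth q) _ (All.lookup (all⁺ _ _ surjective) (∈-allPos q)))
    ...   | (d , x) , e∈ , x-depth = subst (_≤ height t) d≡height (All.lookup (depthLabels-bounded h 0) e∈)
      where
        d≡height : d ≡ height s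
        d≡height = trans (sym (≡ᵇ⇒≡ (depth x) d (All.lookup levels e∈))) (trans (≡ᵇ⇒≡ (depth x) (depth q) x-depth) q-deepest)

isDHom≡rooted-parentOf : ∀ {s t} → height s ≤ height t → (h : Lab (Pos s) t) →
                         isDHom h ≡ (depth (rootLabel h) ≡ᵇ 0) ∧ edgesOK parentOf h
isDHom≡rooted-parentOf s≤t h = begin
  edgesOK treeAdj h ∧ (all levelled (depthLabels 0 h) ∧ _)
    ≡⟨ cong (edgesOK treeAdj h ∧_) (∧-dropʳ _ _ (levelled⇒depthSurjective h s≤t)) ⟩
  edgesOK treeAdj h ∧ all levelled (depthLabels 0 h)
    ≡⟨ levelled-edgesOK 0 h ⟩
  (depth (rootLabel h) ≡ᵇ 0) ∧ edgesOK parentOf h ∎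

∑-at-root : ∀ ts (f : Pos (node ts) → ℕ) → ∑ (λ a → ⟦ depth a ≡ᵇ 0 ⟧ * f a) (allPos (node ts)) ≡ f root
∑-at-root ts f = begin
  f root + 0 + ∑ (λ a → ⟦ depth a ≡ᵇ 0 ⟧ * f a) (map down (allPosIn ts))
    ≡⟨ cong₂ _+_ (+-identityʳ (f root)) (trans (∑-map _ down (allPosIn ts)) (∑-zero (allPosIn ts))) ⟩
  f root + 0
    ≡⟨ +-identityʳ (f root) ⟩
  f root ∎

dhom≡dphom : ∀ t s → height s ≤ height t → dhom t s ≡ dphom t s
dhom≡dphom t (node ss) s≤t = begin
  dhom t (node ss)
    ≡⟨ count-cong (isDHom≡rooted-parentOf s≤t) (allLab ps t) ⟩
  count (λ h → (depth (rootLabel h) ≡ᵇ 0) ∧ edgesOK parentOf h) (allLab ps t)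
    ≡⟨ count-edgesOK parentOf ps (λ a → depth a ≡ᵇ 0) t ⟩
  ∑ (λ a → ⟦ depth a ≡ᵇ 0 ⟧ * rootedHoms childPositions t a) ps
    ≡⟨ ∑-at-root ss (rootedHoms childPositions t) ⟩
  rootedHoms childPositions t root
    ≡⟨ rootedHoms-simulate childPositions children (λ _ → subtree) (λ _ a → sym (subtree-childPositions a))
                           (height t) t root ≤-refl ⟩
  dphom t (node ss) ∎
  where
    ps : List (Pos (node ss))
    ps = allPos (node ss)

dhom≢0⇒height≡ : ∀ t s → dhom t s ≢ 0 → height s ≡ height t
dhom≢0⇒height≡ t s dhom≢0 with Any.satisfied (count≢0⇒Any isDHom (allLab (allPos s) t) dhom≢0)
... | h , isDHom-h = isDHom⇒height≡ h isDHom-h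

unfoldingTypes : Graph → ℕ → List RTree
unfoldingTypes G k = deduplicate _≅?_ (map (λ v → unfold G v k) (allFin (n G)))

unfoldingTypes-unique : ∀ G k → AllPairs (λ s s′ → ¬ s ≅ s′) (unfoldingTypes G k)
unfoldingTypes-unique G k = deduplicate-! ≅-decSetoid (map (λ v → unfold G v k) (allFin (n G)))

≅unfold⇒∈unfoldingTypes : ∀ {s} G k v → s ≅ unfold G v k → Any (s ≅_) (unfoldingTypes G k)
≅unfold⇒∈unfoldingTypes G k v s≅v =
  Any.deduplicate⁺ _≅?_ (λ y≅x s≅x → ≅-trans s≅x (≅-sym y≅x)) (lose (∈-map⁺ (λ v → unfold G v k) (∈-allFin v)) s≅v)

height-unfoldingTypes : ∀ G k → All (λ s → height s ≤ k) (unfoldingTypes G k)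
height-unfoldingTypes G k = All.deduplicate⁺ _≅?_ (All.map⁺ (All.tabulate (λ {v} _ → height-unfold G v k)))

dhom*cr-at-height : ∀ t s G →
  dhom t s * count (λ v → isYes (s ≅? unfold G v (height t))) (allFin (n G)) ≡ dhom t s * cr s G
dhom*cr-at-height t s G with dhom t s ℕ.≟ 0
... | yes dhom≡0 rewrite dhom≡0                  = refl
... | no  dhom≢0 rewrite dhom≢0⇒height≡ t s dhom≢0 = refl

hom≡∑dhom*cr : ∀ t G → hom t G ≡ ∑ (λ s → dhom t s * cr s G) (unfoldingTypes G (height t))
hom≡∑dhom*cr t G = begin
  hom t G
    ≡⟨ hom≡∑dphom t G ⟩
  ∑ (λ v → dphom t (U v)) vs
    ≡⟨ ∑-cong (λ v → sym (∑-representative ≅-decSetoid (dphom t) (dphom-cong t) (unfoldingTypes-unique G k)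
                            (≅unfold⇒∈unfoldingTypes G k v (≅-refl (U v))))) vs ⟩
  ∑ (λ v → ∑ (λ s → ⟦ isYes (s ≅? U v) ⟧ * dphom t s) L) vs
    ≡⟨ ∑-swap (λ v s → ⟦ isYes (s ≅? U v) ⟧ * dphom t s) vs L ⟩
  ∑ (λ s → ∑ (λ v → ⟦ isYes (s ≅? U v) ⟧ * dphom t s) vs) L
    ≡⟨ ∑-congᴬ (All.map (λ {s} → per-type s) (height-unfoldingTypes G k)) ⟩
  ∑ (λ s → dhom t s * cr s G) L ∎
  where
    k : ℕ
    k = height t
    vs : List (Fin (n G))
    vs = allFin (n G)
    L : List RTree
    L = unfoldingTypes G k
    U : Fin (n G) → RTree
    U v = unfold G v k

    per-type : ∀ s → height s ≤ k → ∑ (λ v → ⟦ isYes (s ≅? U v) ⟧ * dphom t s) vs ≡ dhom t s * cr s G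
    per-type s s≤t = begin
      ∑ (λ v → ⟦ isYes (s ≅? U v) ⟧ * dphom t s) vs
        ≡⟨ ∑-*ʳ _ _ vs ⟩
      ∑ (λ v → ⟦ isYes (s ≅? U v) ⟧) vs * dphom t s
        ≡⟨ cong₂ _*_ (sym (count≡∑ _ vs)) (sym (dhom≡dphom t s s≤t)) ⟩
      count (λ v → isYes (s ≅? U v)) vs * dhom t s
        ≡⟨ *-comm _ (dhom t s) ⟩
      dhom t s * count (λ v → isYes (s ≅? U v)) vs
        ≡⟨ dhom*cr-at-height t s G ⟩
      dhom t s * cr s G ∎

dhom*cr≢0⇒∈unfoldingTypes : ∀ t G s → dhom t s * cr s G ≢ 0 → Any (s ≅_) (unfoldingTypes G (height t))
dhom*cr≢0⇒∈unfoldingTypes t G s dhom*cr≢0 with m*n≢0⇒m≢0×n≢0 (dhom t s) (cr s G) dhom*cr≢0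
... | dhom≢0 , cr≢0
  with Any.satisfied (count≢0⇒Any (λ v → isYes (s ≅? unfold G v (height s))) (allFin (n G)) cr≢0)
...   | v , s≅v = subst (λ k → Any (s ≅_) (unfoldingTypes G k)) (dhom≢0⇒height≡ t s dhom≢0)
                        (≅unfold⇒∈unfoldingTypes G (height s) v (toWitness s≅v))

mainTheorem6 : (T : RTree) (G : Graph) →
    Σ (List RTree) λ L →
    AllPairs (λ S S′ → ¬ (S ≅ S′)) L
    × (∀ T′ → dhom T T′ * cr T′ G ≢ 0 → Any (λ S → T′ ≅ S) L)
    × hom T G ≡ sum (map (λ T′ → dhom T T′ * cr T′ G) L)
mainTheorem6 T G =
  unfoldingTypes G (height T) ,
  unfoldingTypes-unique G (height T) ,
  dhom*cr≢0⇒∈unfoldingTypes T G ,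
  trans (hom≡∑dhom*cr T G) (sym (sum-map≡∑ _ (unfoldingTypes G (height T))))
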